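{- Let $k\ge1$, let $p$ be an alternating Motzkin path of length $2k$, and let $i$ be an integer with $0\le i\le k-1$. Then the number of level steps of $p$ at altitude $i$ is even, and exactly half of them occur at even-numbered steps.
   Context: A Motzkin path of length $2k$ is a lattice path of $2k$ steps, each a rise $(1,1)$, a fall $(1,-1)$ or a level step $(1,0)$, starting at $(0,0)$, ending at $(2k,0)$, never going below the $x$-axis. Steps are numbered $1,2,\dots,2k$ from left to right. An alternating Motzkin path is a Motzkin path in which rises occur only at even-numbered steps and falls occur only at odd-numbered steps. The altitude of a level step is the $y$-coordinate of its endpoints. -}

module Defs where

open import Data.Nat using (ℕ; zero; suc; _+_; _*_)
open import Data.Bool using (Bool; true; false; _∧_)
open import Data.Integer using (ℤ; +_; -[1+_]; _≤_)
import Data.Integer as ℤ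
open import Data.Fin using (Fin; toℕ; inject₁; fromℕ; suc)
open import Data.Vec.Functional using (Vector)
open import Data.Integer using () renaming (_≟_ to _≟ℤ_)
open import Relation.Nullary.Decidable using (⌊_⌋)
open import Data.Product using (_×_)
open import Relation.Binary.PropositionalEquality using (_≡_)

even : ℕ → Bool
even zero = true
even (suc zero) = false
even (suc (suc n)) = even n

data Step : Set where
  rise fall level : Step

δ : Step → ℤ
δ rise  = + 1
δ fall  = -[1+ 0 ]
δ level = + 0

-- A path of length n: step number (toℕ j + 1) is  p j , for j : Fin n.
Path : ℕ → Set
Path n = Vector Step n

-- y-coordinate after the first m steps (m ≤ n, given as Fin (suc n)).
height : ∀ {n} → Path n → Fin (suc n) → ℤ
height {zero}  p _        = + 0
height {suc n} p Fin.zero = + 0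
height {suc n} p (suc m)  = δ (p Fin.zero) ℤ.+ height (λ j → p (suc j)) m

IsMotzkin : ∀ {n} → Path n → Set
IsMotzkin {n} p = (∀ (m : Fin (suc n)) → + 0 ≤ height p m) × height p (fromℕ n) ≡ + 0

stepNo : ∀ {n} → Fin n → ℕ
stepNo j = suc (toℕ j)

IsAlternating : ∀ {n} → Path n → Set
IsAlternating {n} p =
  (∀ (j : Fin n) → p j ≡ rise → even (stepNo j) ≡ true) ×
  (∀ (j : Fin n) → p j ≡ fall → even (stepNo j) ≡ false)

IsAltMotzkin : ∀ {n} → Path n → Set
IsAltMotzkin p = IsMotzkin p × IsAlternating p

isLevel : Step → Bool
isLevel level = true
isLevel _     = false

-- Step j is a level step at altitude a (altitude = height of its endpoints,
-- here the height after steps 1..stepNo j).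
levelAt : ∀ {n} → Path n → ℕ → Fin n → Bool
levelAt p a j = isLevel (p j) ∧ ⌊ height p (suc j) ≟ℤ + a ⌋

count : ∀ {n} → (Fin n → Bool) → ℕ
count {zero}  P = zero
count {suc n} P with P Fin.zero
... | true  = suc (count (λ j → P (suc j)))
... | false = count (λ j → P (suc j))

numLevel : ∀ {n} → Path n → ℕ → ℕ
numLevel p a = count (levelAt p a)

numLevelEven : ∀ {n} → Path n → ℕ → ℕ
numLevelEven p a = count (λ j → levelAt p a j ∧ even (stepNo j))

-- Weight each point of the path by a potential that, for the target altitude c, is [h < c]
-- before an even-numbered step and [h ≤ c] before an odd-numbered one (h the current height).
-- Alternation makes every rise even-numbered and every fall odd-numbered, so neither changes
-- the potential, while a level step at altitude c lowers it by one if it is odd-numbered and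
-- raises it by one if it is even-numbered. Since the path has even length and returns to
-- height 0, the potential ends where it started, so there are as many odd- as even-numbered
-- level steps at c.
module Submission where

open import Defs
open import Data.Nat using (ℕ; suc; _*_; _<_)
open import Data.Product using (∃; _×_)
open import Relation.Binary.PropositionalEquality using (_≡_)

open import Data.Nat as ℕ using (zero)
import Data.Nat.Properties as ℕ
open import Algebra.Properties.CommutativeSemigroup ℕ.+-commutativeSemigroup
  using (xy∙z≈y∙xz; x∙yz≈y∙xz)
open import Data.Bool using (Bool; true; false; _∧_; not)
open import Data.Bool.Properties using (∧-identityʳ; ∧-zeroʳ; not-involutive)
open import Data.Integer as ℤ using (ℤ; +_; -[1+_]; _≤?_; _≟_)
import Data.Integer.Properties as ℤ
open import Data.Fin using (Fin; toℕ; fromℕ) renaming (zero to fzero; suc to fsuc)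
open import Data.Product using (_,_)
open import Data.Unit using (⊤; tt)
open import Function using (_∘_; id)
open import Relation.Binary.Definitions using (tri<; tri≈; tri>)
open import Relation.Nullary.Decidable using (⌊_⌋; dec-true; dec-false; isYes≗does)
open import Relation.Binary.PropositionalEquality
  using (refl; sym; trans; cong; cong₂; module ≡-Reasoning)
open ≡-Reasoning

𝟙 : Bool → ℕ
𝟙 true  = 1
𝟙 false = 0

count-suc : ∀ {n} (P : Fin (suc n) → Bool) → count P ≡ 𝟙 (P fzero) ℕ.+ count (λ j → P (fsuc j))
count-suc P with P fzero
... | true  = refl
... | false = refl

count-cong : ∀ {n} {P Q : Fin n → Bool} → (∀ j → P j ≡ Q j) → count P ≡ count Q
count-cong {zero}  P≗Q = refl
count-cong {suc n} {P} {Q} P≗Q = begin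
  count P                                  ≡⟨ count-suc P ⟩
  𝟙 (P fzero) ℕ.+ count (λ j → P (fsuc j)) ≡⟨ cong₂ ℕ._+_ (cong 𝟙 (P≗Q fzero)) (count-cong (λ j → P≗Q (fsuc j))) ⟩
  𝟙 (Q fzero) ℕ.+ count (λ j → Q (fsuc j)) ≡⟨ sym (count-suc Q) ⟩
  count Q                                  ∎

count-split : ∀ {n} (P Q : Fin n → Bool) →
  count (λ j → P j ∧ Q j) ℕ.+ count (λ j → P j ∧ not (Q j)) ≡ count P
count-split {zero} P Q = refl
count-split {suc n} P Q
  rewrite count-suc (λ j → P j ∧ Q j) | count-suc (λ j → P j ∧ not (Q j)) | count-suc P
  with P fzero | Q fzero | count-split (λ j → P (fsuc j)) (λ j → Q (fsuc j))
... | true  | true  | ih = cong suc ih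
... | true  | false | ih = trans (ℕ.+-suc _ _) (cong suc ih)
... | false | true  | ih = ih
... | false | false | ih = ih

-- Whether the step at offset m is even-numbered, if the step at offset 0 has evenness b.
evenFrom : Bool → ℕ → Bool
evenFrom b zero    = b
evenFrom b (suc m) = evenFrom (not b) m

evenFrom-false : ∀ m → evenFrom false m ≡ even (suc m)
evenFrom-false zero          = refl
evenFrom-false (suc zero)    = refl
evenFrom-false (suc (suc m)) = evenFrom-false m

evenFrom-even : ∀ b m → even m ≡ true → evenFrom b m ≡ b
evenFrom-even b zero          _      = refl
evenFrom-even b (suc (suc m)) m-even = trans (evenFrom-even (not (not b)) m m-even) (not-involutive b)

even-double : ∀ m → even (m ℕ.+ m) ≡ true
even-double zero    = refl
even-double (suc m) = trans (cong even (cong suc (ℕ.+-suc m m))) (even-double m)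

even-2* : ∀ m → even (2 * m) ≡ true
even-2* m = trans (cong (λ n → even (m ℕ.+ n)) (ℕ.+-identityʳ m)) (even-double m)

AlternatingStep : Bool → Step → Set
AlternatingStep e rise  = e ≡ true
AlternatingStep e fall  = e ≡ false
AlternatingStep e level = ⊤

AlternatingFrom : ∀ {n} → Bool → Path n → Set
AlternatingFrom b q = ∀ j → AlternatingStep (evenFrom b (toℕ j)) (q j)

isAlternating⇒alternatingFrom : ∀ {n} (p : Path n) → IsAlternating p → AlternatingFrom false p
isAlternating⇒alternatingFrom p (rise-even , fall-odd) j
  rewrite evenFrom-false (toℕ j) with p j in pj
... | rise  = rise-even j pj
... | fall  = fall-odd j pj
... | level = tt

-- e is the evenness of the next step; [h < c] is written [suc h ≤ c].
potential : Bool → ℤ → ℤ → ℕ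
potential true  h c = 𝟙 ⌊ ℤ.suc h ≤? c ⌋
potential false h c = 𝟙 ⌊ h ≤? c ⌋

potential-level : ∀ h c → 𝟙 ⌊ h ≟ c ⌋ ℕ.+ potential true h c ≡ potential false h c
potential-level h c
  rewrite isYes≗does (h ≟ c) | isYes≗does (ℤ.suc h ≤? c) | isYes≗does (h ≤? c)
  with ℤ.<-cmp h c
... | tri< h<c h≢c _
  rewrite dec-false (h ≟ c) h≢c | dec-true (ℤ.suc h ≤? c) (ℤ.i<j⇒suc[i]≤j h<c)
        | dec-true (h ≤? c) (ℤ.<⇒≤ h<c) = refl
... | tri≈ _ refl _
  rewrite dec-true (h ≟ h) refl | dec-true (h ≤? h) ℤ.≤-refl
        | dec-false (ℤ.suc h ≤? h) (ℤ.<-irrefl refl ∘ ℤ.suc[i]≤j⇒i<j) = refl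
... | tri> _ h≢c c<h
  rewrite dec-false (h ≟ c) h≢c | dec-false (h ≤? c) (ℤ.<⇒≱ c<h)
        | dec-false (ℤ.suc h ≤? c) (ℤ.<⇒≱ c<h ∘ ℤ.<⇒≤ ∘ ℤ.suc[i]≤j⇒i<j) = refl

potential-step : ∀ x e h c → AlternatingStep e x →
  𝟙 ((isLevel x ∧ ⌊ h ℤ.+ δ x ≟ c ⌋) ∧ e) ℕ.+ potential e h c
    ≡ 𝟙 ((isLevel x ∧ ⌊ h ℤ.+ δ x ≟ c ⌋) ∧ not e) ℕ.+ potential (not e) (h ℤ.+ δ x) c
potential-step rise .true h c refl rewrite ℤ.+-comm h (+ 1) = refl
potential-step fall .false h c refl
  rewrite ℤ.+-comm h -[1+ 0 ] | ℤ.suc-pred h = refl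
potential-step level true h c _
  rewrite ℤ.+-identityʳ h | ∧-identityʳ ⌊ h ≟ c ⌋ | ∧-zeroʳ ⌊ h ≟ c ⌋ = potential-level h c
potential-step level false h c _
  rewrite ℤ.+-identityʳ h | ∧-identityʳ ⌊ h ≟ c ⌋ | ∧-zeroʳ ⌊ h ≟ c ⌋ = sym (potential-level h c)

height-zero : ∀ {n} (q : Path n) → height q fzero ≡ + 0
height-zero {zero}  q = refl
height-zero {suc n} q = refl

levelFrom : ∀ {n} → ℤ → Path n → ℤ → Fin n → Bool
levelFrom h q c j = isLevel (q j) ∧ ⌊ h ℤ.+ height q (fsuc j) ≟ c ⌋

countLevels : ∀ {n} → (Bool → Bool) → Bool → ℤ → Path n → ℤ → ℕ
countLevels s b h q c = count (λ j → levelFrom h q c j ∧ s (evenFrom b (toℕ j)))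

countLevels-suc : ∀ {n} s b h (q : Path (suc n)) c →
  countLevels s b h q c
    ≡ 𝟙 ((isLevel (q fzero) ∧ ⌊ h ℤ.+ δ (q fzero) ≟ c ⌋) ∧ s b)
      ℕ.+ countLevels s (not b) (h ℤ.+ δ (q fzero)) (λ j → q (fsuc j)) c
countLevels-suc s b h q c =
  trans (count-suc (λ j → levelFrom h q c j ∧ s (evenFrom b (toℕ j))))
        (cong₂ ℕ._+_ (cong (λ ℓ → 𝟙 (ℓ ∧ s b)) first) (count-cong rest))
  where
  x  = q fzero
  q′ = λ j → q (fsuc j)
  first : levelFrom h q c fzero ≡ (isLevel x ∧ ⌊ h ℤ.+ δ x ≟ c ⌋)
  first rewrite height-zero q′ | ℤ.+-identityʳ (δ x) = refl
  rest : ∀ j → levelFrom h q c (fsuc j) ∧ s (evenFrom (not b) (toℕ j))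
             ≡ levelFrom (h ℤ.+ δ x) q′ c j ∧ s (evenFrom (not b) (toℕ j))
  rest j rewrite ℤ.+-assoc h (δ x) (height q′ (fsuc j)) = refl

balance : ∀ {n} b h c (q : Path n) → AlternatingFrom b q →
  countLevels id b h q c ℕ.+ potential b h c
    ≡ countLevels not b h q c ℕ.+ potential (evenFrom b n) (h ℤ.+ height q (fromℕ n)) c
balance {zero} b h c q _ rewrite ℤ.+-identityʳ h = refl
balance {suc n} b h c q alt = begin
  countLevels id b h q c ℕ.+ potential b h c
    ≡⟨ cong (ℕ._+ potential b h c) (countLevels-suc id b h q c) ⟩
  (𝟙 (ℓ ∧ b) ℕ.+ E′) ℕ.+ potential b h c
    ≡⟨ xy∙z≈y∙xz (𝟙 (ℓ ∧ b)) E′ _ ⟩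
  E′ ℕ.+ (𝟙 (ℓ ∧ b) ℕ.+ potential b h c)
    ≡⟨ cong (E′ ℕ.+_) (potential-step x b h c (alt fzero)) ⟩
  E′ ℕ.+ (𝟙 (ℓ ∧ not b) ℕ.+ potential (not b) h′ c)
    ≡⟨ x∙yz≈y∙xz E′ (𝟙 (ℓ ∧ not b)) _ ⟩
  𝟙 (ℓ ∧ not b) ℕ.+ (E′ ℕ.+ potential (not b) h′ c)
    ≡⟨ cong (𝟙 (ℓ ∧ not b) ℕ.+_) (balance (not b) h′ c q′ (λ j → alt (fsuc j))) ⟩
  𝟙 (ℓ ∧ not b) ℕ.+ (O′ ℕ.+ potential (evenFrom b (suc n)) (h′ ℤ.+ height q′ (fromℕ n)) c)
    ≡⟨ sym (ℕ.+-assoc (𝟙 (ℓ ∧ not b)) O′ _) ⟩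
  (𝟙 (ℓ ∧ not b) ℕ.+ O′) ℕ.+ potential (evenFrom b (suc n)) (h′ ℤ.+ height q′ (fromℕ n)) c
    ≡⟨ cong₂ (λ O h″ → O ℕ.+ potential (evenFrom b (suc n)) h″ c)
             (sym (countLevels-suc not b h q c)) (ℤ.+-assoc h (δ x) (height q′ (fromℕ n))) ⟩
  countLevels not b h q c ℕ.+ potential (evenFrom b (suc n)) (h ℤ.+ height q (fromℕ (suc n))) c
    ∎
  where
  x  = q fzero
  q′ = λ j → q (fsuc j)
  h′ = h ℤ.+ δ x
  ℓ  = isLevel x ∧ ⌊ h′ ≟ c ⌋
  E′ = countLevels id (not b) h′ q′ c
  O′ = countLevels not (not b) h′ q′ c

evenLevels≡oddLevels : ∀ {n} (q : Path n) → even n ≡ true → height q (fromℕ n) ≡ + 0 →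
  AlternatingFrom false q → ∀ c → countLevels id false (+ 0) q c ≡ countLevels not false (+ 0) q c
evenLevels≡oddLevels {n} q n-even returns alt c =
  ℕ.+-cancelʳ-≡ (potential false (+ 0) c) _ _
    (trans (balance false (+ 0) c q alt) (cong (countLevels not false (+ 0) q c ℕ.+_) potential-returns))
  where
  potential-returns : potential (evenFrom false n) (+ 0 ℤ.+ height q (fromℕ n)) c ≡ potential false (+ 0) c
  potential-returns = cong₂ (λ e h → potential e h c)
    (evenFrom-even false n n-even) (trans (ℤ.+-identityˡ _) returns)

lemma1 : (k : ℕ) → (p : Path (2 * suc k)) → IsAltMotzkin p →
    (i : ℕ) → i < suc k →
    ∃ λ m → numLevel p i ≡ 2 * m × numLevelEven p i ≡ m
lemma1 k p ((_ , returns) , alternating) i _ = E , numLevel≡2*E , numLevelEven≡E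
  where
  c = + i
  E = countLevels id false (+ 0) p c
  O = countLevels not false (+ 0) p c

  E≡O : E ≡ O
  E≡O = evenLevels≡oddLevels p (even-2* (suc k)) returns (isAlternating⇒alternatingFrom p alternating) c

  levelAt≡levelFrom : ∀ j → levelAt p i j ≡ levelFrom (+ 0) p c j
  levelAt≡levelFrom j rewrite ℤ.+-identityˡ (height p (fsuc j)) = refl

  numLevel≡2*E : numLevel p i ≡ 2 * E
  numLevel≡2*E = begin
    count (levelAt p i)         ≡⟨ count-cong levelAt≡levelFrom ⟩
    count (levelFrom (+ 0) p c) ≡⟨ sym (count-split (levelFrom (+ 0) p c) (λ j → evenFrom false (toℕ j))) ⟩
    E ℕ.+ O                     ≡⟨ cong (E ℕ.+_) (trans (sym E≡O) (sym (ℕ.+-identityʳ E))) ⟩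
    2 * E                       ∎

  numLevelEven≡E : numLevelEven p i ≡ E
  numLevelEven≡E = count-cong (λ j → cong₂ _∧_ (levelAt≡levelFrom j) (sym (evenFrom-false (toℕ j))))
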